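{- Let $G=(V,E)$ be an unweighted graph with $V=\{v_1,\dots,v_n\}$, $n\ge1$. Let $G'=(V',E')$ with $V'=V\cup\{u^*,u_1,\dots,u_n\}$ (new vertices) and $E'=E\cup\{\{u^*,u_i\}:i\in[n]\}\cup\{\{u^*,v_1\}\}$. Let $S^*_{ft}$ be a cut of $G'$ maximizing $\varphi(\cdot,1,G')$ and $S^*_{mc}$ a maximum cut of $G$. Then $\varphi(S^*_{ft},1,G')=C_{S^*_{mc},G}$.
   Context: For a graph $H$ and $S\subseteq V(H)$, $C_{S,H}$ is the number of edges of $H$ with exactly one endpoint in $S$. For $F\subseteq V(H)$, $H-F$ deletes $F$ and incident edges. $\varphi(S,1,H)=\min_{v\in V(H)}C_{S-\{v\},H-\{v\}}$. -}

module Defs where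

open import Data.Nat using (ℕ; zero; suc; _+_; _<_; _≤_; _⊓_)
open import Data.Bool using (Bool; true; false; _∧_; _xor_; if_then_else_)
open import Data.Fin using (Fin; zero; suc; toℕ; punchIn; splitAt)
open import Data.Sum using (inj₁; inj₂)
open import Data.Nat using (_<ᵇ_)
open import Relation.Binary.PropositionalEquality using (_≡_)

-- An unweighted graph on vertex set Fin m, given by a Bool-valued adjacency
-- relation. Simplicity (symmetry, irreflexivity) is imposed as hypotheses.
record Graph (m : ℕ) : Set where
  constructor graph
  field
    adj : Fin m → Fin m → Bool
open Graph public

SymmetricG : ∀ {m} → Graph m → Set
SymmetricG {m} H = (i j : Fin m) → adj H i j ≡ adj H j i

IrreflexiveG : ∀ {m} → Graph m → Set
IrreflexiveG {m} H = (i : Fin m) → adj H i i ≡ false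

Cut : ℕ → Set
Cut m = Fin m → Bool

Σ-fin : (m : ℕ) → (Fin m → ℕ) → ℕ
Σ-fin zero    f = 0
Σ-fin (suc m) f = f zero + Σ-fin m (λ i → f (suc i))

min-fin : (m : ℕ) → (Fin (suc m) → ℕ) → ℕ
min-fin zero    f = f zero
min-fin (suc m) f = f zero ⊓ min-fin m (λ i → f (suc i))

ind : Bool → ℕ
ind true  = 1
ind false = 0

-- C_{S,H}: number of edges {i,j} (counted once, via toℕ i < toℕ j) with
-- exactly one endpoint in S.
C : ∀ {m} → Cut m → Graph m → ℕ
C {m} S H = Σ-fin m λ i → Σ-fin m λ j →
  ind ((toℕ i <ᵇ toℕ j) ∧ adj H i j ∧ (S i xor S j))

delete : ∀ {m} → Graph (suc m) → Fin (suc m) → Graph m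
delete H v = graph (λ i j → adj H (punchIn v i) (punchIn v j))

restrict : ∀ {m} → Cut (suc m) → Fin (suc m) → Cut m
restrict S v = λ i → S (punchIn v i)

φ1 : ∀ {m} → Cut (suc m) → Graph (suc m) → ℕ
φ1 {m} S H = min-fin m (λ v → C (restrict S v) (delete H v))

IsMaxCut : ∀ {m} → Graph m → Cut m → Set
IsMaxCut {m} H S = (T : Cut m) → C T H ≤ C S H

IsMaxφ1 : ∀ {m} → Graph (suc m) → Cut (suc m) → Set
IsMaxφ1 {m} H S = (T : Cut (suc m)) → φ1 T H ≤ φ1 S H

-- Vertices of G' for |V| = n: Fin (suc (n + n)), where
--   zero           = u*,
--   suc (inject i) = v_{i+1}  (first n, via splitAt n → inj₁ i),
--   suc (raise i)  = u_{i+1}  (last n,  via splitAt n → inj₂ i).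
data Kind (n : ℕ) : Set where
  star : Kind n
  vv   : Fin n → Kind n
  uu   : Fin n → Kind n

kind : ∀ n → Fin (suc (n + n)) → Kind n
kind n zero = star
kind n (suc a) with splitAt n a
... | inj₁ i = vv i
... | inj₂ i = uu i

isZero : ∀ {n} → Fin n → Bool
isZero zero    = true
isZero (suc _) = false

adj' : ∀ {n} → Graph n → Kind n → Kind n → Bool
adj' G (vv i) (vv j) = adj G i j
adj' G star   (uu _) = true
adj' G (uu _) star   = true
adj' G star   (vv i) = isZero i     -- edge {u*, v_1}
adj' G (vv i) star   = isZero i
adj' G _      _      = false

G′ : ∀ {n} → Graph n → Graph (suc (n + n))
G′ {n} G = graph (λ a b → adj' G (kind n a) (kind n b))

-- Count every crossing edge twice, as an ordered pair; for symmetric graphs this doubled count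
-- is 2C, and deleting v removes exactly twice the cut degree of v.  Hence
-- C(S − v, H − v) = C(S, H) − deg_S(v).  Deleting u* from G′ leaves G plus isolated vertices,
-- so φ(T, 1, G′) is at most a cut value of G.  Conversely, extend a maximum cut of G by putting
-- u* on the side of v₁ and all uᵢ on the other side: this cut of G′ has value C(S*_mc, G) + n
-- and every vertex has cut degree at most n, so every deletion leaves at least C(S*_mc, G).
module Submission where

open import Defs
open import Data.Nat using (ℕ; zero; suc; _+_; _≤_; _<ᵇ_; z≤n; s≤s)
open import Relation.Binary.PropositionalEquality using (_≡_; refl; sym; trans; cong; cong₂; module ≡-Reasoning)
open import Data.Bool using (Bool; true; false; not; _∧_; _xor_)
open import Data.Bool.Properties using (xor-same; xor-comm; xor-inverseˡ; xor-inverseʳ; ∧-zeroʳ)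
open import Data.Fin using (Fin; zero; suc; toℕ; punchIn; splitAt; _↑ˡ_; _↑ʳ_)
open import Data.Fin.Properties using (splitAt-↑ˡ; splitAt-↑ʳ)
open import Data.Nat.Properties
open import Algebra.Properties.CommutativeSemigroup +-commutativeSemigroup using (interchange; x∙yz≈y∙xz)
open import Data.Sum using (inj₁; inj₂)

m+m≤n+n⇒m≤n : ∀ {m n} → m + m ≤ n + n → m ≤ n
m+m≤n+n⇒m≤n le = ≮⇒≥ (λ n<m → <⇒≱ (+-mono-< n<m n<m) le)

m+m≡n+n⇒m≡n : ∀ {m n} → m + m ≡ n + n → m ≡ n
m+m≡n+n⇒m≡n eq = ≤-antisym (m+m≤n+n⇒m≤n (≤-reflexive eq)) (m+m≤n+n⇒m≤n (≤-reflexive (sym eq)))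

min-fin-≤ : ∀ m (f : Fin (suc m) → ℕ) v → min-fin m f ≤ f v
min-fin-≤ zero    f zero    = ≤-refl
min-fin-≤ (suc m) f zero    = m⊓n≤m _ _
min-fin-≤ (suc m) f (suc v) = ≤-trans (m⊓n≤n _ _) (min-fin-≤ m (λ i → f (suc i)) v)

min-fin-glb : ∀ m (f : Fin (suc m) → ℕ) {x} → (∀ v → x ≤ f v) → x ≤ min-fin m f
min-fin-glb zero    f h = h zero
min-fin-glb (suc m) f h = ⊓-glb (h zero) (min-fin-glb m (λ i → f (suc i)) (λ i → h (suc i)))

Σ-cong : ∀ m {f g : Fin m → ℕ} → (∀ i → f i ≡ g i) → Σ-fin m f ≡ Σ-fin m g
Σ-cong zero    h = refl
Σ-cong (suc m) h = cong₂ _+_ (h zero) (Σ-cong m (λ i → h (suc i)))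

Σ-zero : ∀ m {f : Fin m → ℕ} → (∀ i → f i ≡ 0) → Σ-fin m f ≡ 0
Σ-zero zero    h = refl
Σ-zero (suc m) h = cong₂ _+_ (h zero) (Σ-zero m (λ i → h (suc i)))

Σ-one : ∀ m {f : Fin m → ℕ} → (∀ i → f i ≡ 1) → Σ-fin m f ≡ m
Σ-one zero    h = refl
Σ-one (suc m) h = cong₂ _+_ (h zero) (Σ-one m (λ i → h (suc i)))

Σ-≤ : ∀ m {f : Fin m → ℕ} → (∀ i → f i ≤ 1) → Σ-fin m f ≤ m
Σ-≤ zero    h = z≤n
Σ-≤ (suc m) h = +-mono-≤ (h zero) (Σ-≤ m (λ i → h (suc i)))

ind≤1 : ∀ b → ind b ≤ 1
ind≤1 true  = ≤-refl
ind≤1 false = z≤n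

Σ-+ : ∀ m (f g : Fin m → ℕ) → Σ-fin m (λ i → f i + g i) ≡ Σ-fin m f + Σ-fin m g
Σ-+ zero    f g = refl
Σ-+ (suc m) f g = trans (cong (f zero + g zero +_) (Σ-+ m (λ i → f (suc i)) (λ i → g (suc i))))
                        (interchange (f zero) (g zero) _ _)

Σ-punchIn : ∀ m (v : Fin (suc m)) (f : Fin (suc m) → ℕ) →
  Σ-fin (suc m) f ≡ f v + Σ-fin m (λ i → f (punchIn v i))
Σ-punchIn m       zero    f = refl
Σ-punchIn (suc m) (suc v) f = trans (cong (f zero +_) (Σ-punchIn m v (λ i → f (suc i))))
                                    (x∙yz≈y∙xz (f zero) (f (suc v)) _)

Σ-↑ : ∀ n m (f : Fin (n + m) → ℕ) →
  Σ-fin (n + m) f ≡ Σ-fin n (λ i → f (i ↑ˡ m)) + Σ-fin m (λ i → f (n ↑ʳ i))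
Σ-↑ zero    m f = refl
Σ-↑ (suc n) m f = trans (cong (f zero +_) (Σ-↑ n m (λ i → f (suc i)))) (sym (+-assoc (f zero) _ _))

pairs : ∀ m → (Fin m → Fin m → Bool) → ℕ
pairs m b = Σ-fin m λ i → Σ-fin m λ j → ind (b i j)

pairs< : ∀ m → (Fin m → Fin m → Bool) → ℕ
pairs< m b = Σ-fin m λ i → Σ-fin m λ j → ind ((toℕ i <ᵇ toℕ j) ∧ b i j)

pairs<-double : ∀ m (b : Fin m → Fin m → Bool) → (∀ i j → b i j ≡ b j i) → (∀ i → b i i ≡ false) →
  pairs< m b + pairs< m b ≡ pairs m b
pairs<-double zero    b sym-b irr-b = refl
pairs<-double (suc m) b sym-b irr-b = begin
    (R + P) + (R + P)
  ≡⟨ interchange R P R P ⟩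
    (R + R) + (P + P)
  ≡⟨ cong ((R + R) +_) (pairs<-double m b′ (λ i j → sym-b (suc i) (suc j)) (λ i → irr-b (suc i))) ⟩
    (R + R) + pairs m b′
  ≡⟨ +-assoc R R (pairs m b′) ⟩
    R + (R + pairs m b′)
  ≡⟨ cong₂ (λ x y → (ind x + R) + (y + pairs m b′))
       (sym (irr-b zero)) (Σ-cong m (λ i → cong ind (sym-b zero (suc i)))) ⟩
    (ind (b zero zero) + R) + (Σ-fin m (λ i → ind (b (suc i) zero)) + pairs m b′)
  ≡⟨ cong ((ind (b zero zero) + R) +_) (sym (Σ-+ m _ _)) ⟩
    pairs (suc m) b
  ∎
  where
  open ≡-Reasoning
  b′ : Fin m → Fin m → Bool
  b′ i j = b (suc i) (suc j)
  R P : ℕ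
  R = Σ-fin m (λ j → ind (b zero (suc j)))
  P = pairs< m b′

crosses : ∀ {m} → Graph m → Cut m → Fin m → Fin m → Bool
crosses H S i j = adj H i j ∧ (S i xor S j)

crosses-sym : ∀ {m} (H : Graph m) (S : Cut m) → SymmetricG H → ∀ i j → crosses H S i j ≡ crosses H S j i
crosses-sym H S sym-H i j = cong₂ _∧_ (sym-H i j) (xor-comm (S i) (S j))

crosses-irrefl : ∀ {m} (H : Graph m) (S : Cut m) i → crosses H S i i ≡ false
crosses-irrefl H S i = trans (cong (adj H i i ∧_) (xor-same (S i))) (∧-zeroʳ (adj H i i))

C₂ : ∀ {m} → Cut m → Graph m → ℕ
C₂ {m} S H = pairs m (crosses H S)

cutDegree : ∀ {m} → Cut m → Graph m → Fin m → ℕ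
cutDegree {m} S H v = Σ-fin m (λ j → ind (crosses H S v j))

C-cong : ∀ {m} {S T : Cut m} (H : Graph m) → (∀ i → S i ≡ T i) → C S H ≡ C T H
C-cong {m} H S≗T = Σ-cong m λ i → Σ-cong m λ j →
  cong (λ x → ind ((toℕ i <ᵇ toℕ j) ∧ adj H i j ∧ x)) (cong₂ _xor_ (S≗T i) (S≗T j))

C-double : ∀ {m} (S : Cut m) (H : Graph m) → SymmetricG H → C S H + C S H ≡ C₂ S H
C-double {m} S H sym-H = pairs<-double m (crosses H S) (crosses-sym H S sym-H) (crosses-irrefl H S)

delete-sym : ∀ {m} (H : Graph (suc m)) v → SymmetricG H → SymmetricG (delete H v)
delete-sym H v sym-H i j = sym-H (punchIn v i) (punchIn v j)

C₂-delete : ∀ {m} (S : Cut (suc m)) (H : Graph (suc m)) v → SymmetricG H →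
  C₂ S H ≡ C₂ (restrict S v) (delete H v) + (cutDegree S H v + cutDegree S H v)
C₂-delete {m} S H v sym-H = begin
    C₂ S H
  ≡⟨ Σ-punchIn m v row ⟩
    d + Σ-fin m (λ i → row (punchIn v i))
  ≡⟨ cong (d +_) (Σ-cong m (λ i → Σ-punchIn m v (e (punchIn v i)))) ⟩
    d + Σ-fin m (λ i → e (punchIn v i) v + Σ-fin m (λ j → e (punchIn v i) (punchIn v j)))
  ≡⟨ cong (d +_) (Σ-+ m _ _) ⟩
    d + (Σ-fin m (λ i → e (punchIn v i) v) + C₂′)
  ≡⟨ cong (λ x → d + (x + C₂′)) column≡row ⟩
    d + (d + C₂′)
  ≡⟨ trans (sym (+-assoc d d C₂′)) (+-comm (d + d) C₂′) ⟩
    C₂′ + (d + d)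
  ∎
  where
  open ≡-Reasoning
  e : Fin (suc m) → Fin (suc m) → ℕ
  e i j = ind (crosses H S i j)
  row : Fin (suc m) → ℕ
  row i = Σ-fin (suc m) (e i)
  d C₂′ : ℕ
  d = cutDegree S H v
  C₂′ = C₂ (restrict S v) (delete H v)
  -- The full row of v also contains the diagonal entry, which is 0 because a loop never crosses.
  column≡row : Σ-fin m (λ i → e (punchIn v i) v) ≡ d
  column≡row = begin
      Σ-fin m (λ i → e (punchIn v i) v)
    ≡⟨ Σ-cong m (λ i → cong ind (crosses-sym H S sym-H (punchIn v i) v)) ⟩
      Σ-fin m (λ i → e v (punchIn v i))
    ≡⟨ cong (λ x → ind x + Σ-fin m (λ i → e v (punchIn v i))) (sym (crosses-irrefl H S v)) ⟩
      e v v + Σ-fin m (λ i → e v (punchIn v i))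
    ≡⟨ sym (Σ-punchIn m v (e v)) ⟩
      d
    ∎

C-delete : ∀ {m} (S : Cut (suc m)) (H : Graph (suc m)) v → SymmetricG H →
  C S H ≡ C (restrict S v) (delete H v) + cutDegree S H v
C-delete S H v sym-H = m+m≡n+n⇒m≡n (begin
    C S H + C S H
  ≡⟨ C-double S H sym-H ⟩
    C₂ S H
  ≡⟨ C₂-delete S H v sym-H ⟩
    C₂ S′ H′ + (d + d)
  ≡⟨ cong (_+ (d + d)) (sym (C-double S′ H′ (delete-sym H v sym-H))) ⟩
    (C S′ H′ + C S′ H′) + (d + d)
  ≡⟨ interchange (C S′ H′) (C S′ H′) d d ⟩
    (C S′ H′ + d) + (C S′ H′ + d)
  ∎)
  where
  open ≡-Reasoning
  S′ = restrict S v
  H′ = delete H v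
  d = cutDegree S H v

adj′-sym : ∀ {n} (G : Graph n) → SymmetricG G → (x y : Kind n) → adj' G x y ≡ adj' G y x
adj′-sym G sym-G star   star   = refl
adj′-sym G sym-G star   (vv j) = refl
adj′-sym G sym-G star   (uu j) = refl
adj′-sym G sym-G (vv i) star   = refl
adj′-sym G sym-G (vv i) (vv j) = sym-G i j
adj′-sym G sym-G (vv i) (uu j) = refl
adj′-sym G sym-G (uu i) star   = refl
adj′-sym G sym-G (uu i) (vv j) = refl
adj′-sym G sym-G (uu i) (uu j) = refl

G′-sym : ∀ {n} (G : Graph n) → SymmetricG G → SymmetricG (G′ G)
G′-sym {n} G sym-G a b = adj′-sym G sym-G (kind n a) (kind n b)

inV : ∀ {n} → Fin n → Fin (suc (n + n))
inV {n} i = suc (i ↑ˡ n)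

inU : ∀ {n} → Fin n → Fin (suc (n + n))
inU {n} i = suc (n ↑ʳ i)

kind-inV : ∀ n (i : Fin n) → kind n (inV i) ≡ vv i
kind-inV n i rewrite splitAt-↑ˡ n i n = refl

kind-inU : ∀ n (i : Fin n) → kind n (inU i) ≡ uu i
kind-inU n i rewrite splitAt-↑ʳ n n i = refl

uu-isolated : ∀ {n} (G : Graph n) (i : Fin n) (b : Fin (n + n)) → adj' G (uu i) (kind n (suc b)) ≡ false
uu-isolated {n} G i b with splitAt n b
... | inj₁ _ = refl
... | inj₂ _ = refl

Σ-kind : ∀ n (h : Kind n → ℕ) →
  Σ-fin (suc (n + n)) (λ a → h (kind n a)) ≡ h star + (Σ-fin n (λ i → h (vv i)) + Σ-fin n (λ i → h (uu i)))
Σ-kind n h = cong (h star +_) (trans (Σ-↑ n n (λ a → h (kind n (suc a))))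
  (cong₂ _+_ (Σ-cong n (λ i → cong h (kind-inV n i))) (Σ-cong n (λ i → cong h (kind-inU n i)))))

C₂-G′-delete-star : ∀ {n} (G : Graph n) (T : Cut (suc (n + n))) →
  C₂ (restrict T zero) (delete (G′ G) zero) ≡ C₂ (λ i → T (inV i)) G
C₂-G′-delete-star {n} G T = begin
    C₂ (restrict T zero) (delete (G′ G) zero)
  ≡⟨ Σ-↑ n n row ⟩
    Σ-fin n (λ i → row (i ↑ˡ n)) + Σ-fin n (λ i → row (n ↑ʳ i))
  ≡⟨ cong₂ _+_ (Σ-cong n rowV) (Σ-zero n rowU) ⟩
    C₂ Tᵥ G + 0
  ≡⟨ +-identityʳ _ ⟩
    C₂ Tᵥ G
  ∎
  where
  open ≡-Reasoning
  Tᵥ : Cut n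
  Tᵥ i = T (inV i)
  e : Fin (n + n) → Fin (n + n) → ℕ
  e a b = ind (adj' G (kind n (suc a)) (kind n (suc b)) ∧ (T (suc a) xor T (suc b)))
  row : Fin (n + n) → ℕ
  row a = Σ-fin (n + n) (e a)
  rowU : ∀ i → row (n ↑ʳ i) ≡ 0
  rowU i = Σ-zero (n + n) isolated
    where
    isolated : ∀ b → e (n ↑ʳ i) b ≡ 0
    isolated b rewrite kind-inU n i | uu-isolated G i b = refl
  rowV : ∀ i → row (i ↑ˡ n) ≡ Σ-fin n (λ j → ind (crosses G Tᵥ i j))
  rowV i = trans (Σ-↑ n n (e (i ↑ˡ n))) (trans (cong₂ _+_ (Σ-cong n toV) (Σ-zero n toU)) (+-identityʳ _))
    where
    toV : ∀ j → e (i ↑ˡ n) (j ↑ˡ n) ≡ ind (crosses G Tᵥ i j)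
    toV j rewrite kind-inV n i | kind-inV n j = refl
    toU : ∀ j → e (i ↑ˡ n) (n ↑ʳ j) ≡ 0
    toU j rewrite kind-inV n i | kind-inU n j = refl

C-G′-delete-star : ∀ {n} (G : Graph n) → SymmetricG G → (T : Cut (suc (n + n))) →
  C (restrict T zero) (delete (G′ G) zero) ≡ C (λ i → T (inV i)) G
C-G′-delete-star G sym-G T = m+m≡n+n⇒m≡n (begin
    C T′ (delete (G′ G) zero) + C T′ (delete (G′ G) zero)
  ≡⟨ C-double T′ (delete (G′ G) zero) (delete-sym (G′ G) zero (G′-sym G sym-G)) ⟩
    C₂ T′ (delete (G′ G) zero)
  ≡⟨ C₂-G′-delete-star G T ⟩
    C₂ Tᵥ G
  ≡⟨ sym (C-double Tᵥ G sym-G) ⟩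
    C Tᵥ G + C Tᵥ G
  ∎)
  where
  open ≡-Reasoning
  T′ = restrict T zero
  Tᵥ = λ i → T (inV i)

φ1-G′-≤-maxCut : (k : ℕ) (G : Graph (suc k)) → SymmetricG G → (T : Cut (suc (suc k + suc k))) →
  (Smc : Cut (suc k)) → IsMaxCut G Smc → φ1 T (G′ G) ≤ C Smc G
φ1-G′-≤-maxCut k G sym-G T Smc max-Smc = begin
    φ1 T (G′ G)
  ≤⟨ min-fin-≤ (suc k + suc k) (λ v → C (restrict T v) (delete (G′ G) v)) zero ⟩
    C (restrict T zero) (delete (G′ G) zero)
  ≡⟨ C-G′-delete-star G sym-G T ⟩
    C (λ i → T (inV i)) G
  ≤⟨ max-Smc (λ i → T (inV i)) ⟩
    C Smc G
  ∎
  where open ≤-Reasoning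

module ExtendedCut (k : ℕ) (G : Graph (suc k)) (Smc : Cut (suc k)) where

  n : ℕ
  n = suc k

  -- u* sits with v₁ so that the edge {u*, v₁} is not cut.
  side : Kind n → Bool
  side star   = Smc zero
  side (vv i) = Smc i
  side (uu i) = not (Smc zero)

  S : Cut (suc (n + n))
  S a = side (kind n a)

  crossesK : Kind n → Kind n → ℕ
  crossesK x y = ind (adj' G x y ∧ (side x xor side y))

  degreeK : Kind n → ℕ
  degreeK x = crossesK x star + (Σ-fin n (λ i → crossesK x (vv i)) + Σ-fin n (λ i → crossesK x (uu i)))

  cutDegree≡degreeK : ∀ a → cutDegree S (G′ G) a ≡ degreeK (kind n a)
  cutDegree≡degreeK a = Σ-kind n (crossesK (kind n a))

  star-vv-uncut : ∀ i → crossesK star (vv i) ≡ 0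
  star-vv-uncut zero    = cong (λ x → ind (true ∧ x)) (xor-same (Smc zero))
  star-vv-uncut (suc i) = refl

  vv-star-uncut : ∀ i → crossesK (vv i) star ≡ 0
  vv-star-uncut zero    = cong (λ x → ind (true ∧ x)) (xor-same (Smc zero))
  vv-star-uncut (suc i) = refl

  degreeK-star : degreeK star ≡ n
  degreeK-star = cong₂ _+_ (Σ-zero n star-vv-uncut)
                           (Σ-one n (λ i → cong ind (xor-inverseʳ (Smc zero))))

  degreeK-≤ : ∀ x → degreeK x ≤ n
  degreeK-≤ star   = ≤-reflexive degreeK-star
  degreeK-≤ (vv j) = begin
      degreeK (vv j)
    ≡⟨ cong₂ (λ a c → a + (Σ-fin n (λ i → crossesK (vv j) (vv i)) + c))
             (vv-star-uncut j) (Σ-zero n (λ _ → refl)) ⟩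
      Σ-fin n (λ i → crossesK (vv j) (vv i)) + 0
    ≡⟨ +-identityʳ _ ⟩
      Σ-fin n (λ i → crossesK (vv j) (vv i))
    ≤⟨ Σ-≤ n (λ i → ind≤1 (crosses G Smc j i)) ⟩
      n
    ∎
    where open ≤-Reasoning
  degreeK-≤ (uu j) = begin
      degreeK (uu j)
    ≡⟨ cong₂ _+_ (cong ind (xor-inverseˡ (Smc zero)))
                 (cong₂ _+_ (Σ-zero n (λ _ → refl)) (Σ-zero n (λ _ → refl))) ⟩
      1 + (0 + 0)
    ≤⟨ s≤s z≤n ⟩
      n
    ∎
    where open ≤-Reasoning

  cutDegree-≤ : ∀ v → cutDegree S (G′ G) v ≤ n
  cutDegree-≤ v = ≤-trans (≤-reflexive (cutDegree≡degreeK v)) (degreeK-≤ (kind n v))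

  C-S≡maxCut+n : SymmetricG G → C S (G′ G) ≡ C Smc G + n
  C-S≡maxCut+n sym-G = begin
      C S (G′ G)
    ≡⟨ C-delete S (G′ G) zero (G′-sym G sym-G) ⟩
      C (restrict S zero) (delete (G′ G) zero) + cutDegree S (G′ G) zero
    ≡⟨ cong₂ _+_ (C-G′-delete-star G sym-G S) (cutDegree≡degreeK zero) ⟩
      C (λ i → S (inV i)) G + degreeK star
    ≡⟨ cong₂ _+_ (C-cong G (λ i → cong side (kind-inV n i))) degreeK-star ⟩
      C Smc G + n
    ∎
    where open ≡-Reasoning

  maxCut≤φ1 : SymmetricG G → C Smc G ≤ φ1 S (G′ G)
  maxCut≤φ1 sym-G = min-fin-glb (n + n) (λ v → C (restrict S v) (delete (G′ G) v)) λ v →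
    +-cancelʳ-≤ n _ _ (begin
      C Smc G + n
    ≡⟨ sym (C-S≡maxCut+n sym-G) ⟩
      C S (G′ G)
    ≡⟨ C-delete S (G′ G) v (G′-sym G sym-G) ⟩
      C (restrict S v) (delete (G′ G) v) + cutDegree S (G′ G) v
    ≤⟨ +-monoʳ-≤ _ (cutDegree-≤ v) ⟩
      C (restrict S v) (delete (G′ G) v) + n
    ∎)
    where open ≤-Reasoning

lemma32 : (k : ℕ) (G : Graph (suc k)) → SymmetricG G → IrreflexiveG G →
    (Sft : Cut (suc (suc k + suc k))) → IsMaxφ1 (G′ G) Sft →
    (Smc : Cut (suc k)) → IsMaxCut G Smc →
    φ1 Sft (G′ G) ≡ C Smc G
lemma32 k G sym-G _ Sft max-Sft Smc max-Smc = ≤-antisym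
  (φ1-G′-≤-maxCut k G sym-G Sft Smc max-Smc)
  (≤-trans (ExtendedCut.maxCut≤φ1 k G Smc sym-G) (max-Sft (ExtendedCut.S k G Smc)))
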